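{- Let $\Gamma$ be a connected cubic vertex-transitive graph admitting a partition of its edge set into a $2$-factor $\mathcal{C}$ and a $1$-factor $\mathcal{I}$ such that $\Gamma$ is of alternating cycle quotient type with respect to $\mathcal{C}$. If $\mathcal{C}$ is preserved by a vertex-transitive subgroup $G \le \mathrm{Aut}(\Gamma)$ and the members of $\mathcal{C}$ are $4$-cycles, then $\Gamma$ is isomorphic to the honeycomb toroidal graph $\mathrm{HTG}(m,4,\ell)$, where $m = |\mathcal{C}|$ and $\ell \in \{0,1\}$ is of the same parity as $m$. Moreover, $\mathcal{C}$ is preserved by $\mathrm{Aut}(\Gamma)$.
   Context: For a $2$-factor $\mathcal{C}$ (viewed as the set of its cycles) the quotient graph $\Gamma_{\mathcal{C}}$ has vertex set $\mathcal{C}$, distinct $C,C'$ adjacent iff some vertex of $C$ is adjacent to some vertex of $C'$. $\Gamma$ is of cycle quotient type w.r.t. $\mathcal{C}$ if $\Gamma_{\mathcal{C}}$ is a cycle. The outside neighbour of a vertex $v$ is its neighbour via the edge of $\mathcal{I}$. $\Gamma$ is of alternating cycle quotient type w.r.t. $\mathcal{C}$ if it is of cycle quotient type and for each vertex $v$ neither neighbour of $v$ on its own cycle of $\mathcal{C}$ has its outside neighbour in the same member of $\mathcal{C}$ as the outside neighbour of $v$. A group preserves $\mathcal{C}$ if it maps cycles of $\mathcal{C}$ to cycles of $\mathcal{C}$. For $m \ge 3$, $n\ge 4$ even and $\ell\in\mathbb{Z}_n$ of the same parity as $m$, $\mathrm{HTG}(m,n,\ell)$ is the graph with vertices $u_{i,j}$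 ($i\in\mathbb{Z}_m$, $j\in\mathbb{Z}_n$) and edges $u_{i,j}u_{i,j+1}$ for all $i,j$; $u_{i,j}u_{i+1,j}$ for integers $0\le i\le m-2$ and $j\equiv i \pmod 2$; and $u_{m-1,j}u_{0,j+\ell}$ for $j \equiv m-1\pmod 2$. -}

module Defs where

open import Data.Nat using (ℕ; zero; suc; _+_; _≤_; _%_; NonZero)
open import Data.Nat.Properties using ()
open import Data.Fin using (Fin; toℕ)
open import Data.Fin.Permutation using (Permutation′; _⟨$⟩ʳ_; id; flip; _∘ₚ_)
open import Data.Bool using (Bool; true; false; if_then_else_; _∧_; not)
open import Data.List using (List; allFin; map; _∷_; [])
open import Data.Nat.ListAction using (sum)
open import Data.List.Membership.Propositional using (_∈_)
open import Data.Product using (Σ; ∃; ∃-syntax; _×_; _,_)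
open import Data.Sum using (_⊎_)
open import Relation.Binary.PropositionalEquality using (_≡_; _≢_)
open import Relation.Nullary using (¬_)
open import Function.Bundles using (_↔_; Inverse; _⇔_)

record SimpleGraph (N : ℕ) : Set where
  field
    adj   : Fin N → Fin N → Bool
    sym   : ∀ u v → adj u v ≡ adj v u
    irrfl : ∀ v → adj v v ≡ false
open SimpleGraph public

degreeOf : {N : ℕ} → (Fin N → Fin N → Bool) → Fin N → ℕ
degreeOf {N} R v = sum (map (λ w → if R v w then 1 else 0) (allFin N))

Cubic : {N : ℕ} → SimpleGraph N → Set
Cubic Γ = ∀ v → degreeOf (adj Γ) v ≡ 3

data Reach {N : ℕ} (R : Fin N → Fin N → Bool) : Fin N → Fin N → Set where
  here : ∀ {v} → Reach R v v
  step : ∀ {u v w} → R u v ≡ true → Reach R v w → Reach R u w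

Connected : {N : ℕ} → SimpleGraph N → Set
Connected Γ = ∀ u v → Reach (adj Γ) u v

IsAut : {N : ℕ} → SimpleGraph N → Permutation′ N → Set
IsAut Γ σ = ∀ u v → adj Γ (σ ⟨$⟩ʳ u) (σ ⟨$⟩ʳ v) ≡ adj Γ u v

VertexTransitive : {N : ℕ} → SimpleGraph N → Set
VertexTransitive Γ = ∀ u v → Σ _ λ σ → IsAut Γ σ × σ ⟨$⟩ʳ u ≡ v

record IsAutSubgroup {N : ℕ} (Γ : SimpleGraph N) (G : Permutation′ N → Set) : Set where
  field
    ⊆Aut  : ∀ σ → G σ → IsAut Γ σ
    hasId : G id
    ∘-cl  : ∀ σ τ → G σ → G τ → G (σ ∘ₚ τ)
    inv-cl : ∀ σ → G σ → G (flip σ)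

TransitiveOn : {N : ℕ} → (Permutation′ N → Set) → Set
TransitiveOn {N} G = ∀ (u v : Fin N) → Σ _ λ σ → G σ × σ ⟨$⟩ʳ u ≡ v

-- Edge partition into a 2-factor 𝒞 and a 1-factor ℐ.
-- inC u v ≡ true  iff  uv is an edge of the 2-factor; the remaining edges
-- of Γ form ℐ.

record TwoOneFactorisation {N : ℕ} (Γ : SimpleGraph N) : Set where
  field
    inC    : Fin N → Fin N → Bool
    C-sym  : ∀ u v → inC u v ≡ inC v u
    C⊆E    : ∀ u v → inC u v ≡ true → adj Γ u v ≡ true
    C-2reg : ∀ v → degreeOf inC v ≡ 2
    I-1reg : ∀ v → degreeOf (λ u w → adj Γ u w ∧ not (inC u w)) v ≡ 1
open TwoOneFactorisation public

module _ {N : ℕ} {Γ : SimpleGraph N} (F : TwoOneFactorisation Γ) where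

  SameCycle : Fin N → Fin N → Set
  SameCycle = Reach (inC F)

  IsOutside : Fin N → Fin N → Set
  IsOutside v w = adj Γ v w ≡ true × inC F v w ≡ false

  QuotAdj : Fin N → Fin N → Set
  QuotAdj u v = ¬ SameCycle u v ×
    (∃[ x ] ∃[ y ] SameCycle u x × SameCycle v y × adj Γ x y ≡ true)

  -- Γ_𝒞 is a cycle of length m (m ≥ 3): the members of 𝒞 can be labelled
  -- bijectively by ℤ_m so that Γ_𝒞-adjacency is "labels differ by ±1 mod m".
  QuotientIsCycle : (m : ℕ) → .{{NonZero m}} → Set
  QuotientIsCycle m = 3 ≤ m × Σ (Fin N → Fin m) λ f →
      (∀ (a : Fin m) → ∃[ v ] f v ≡ a)
    × (∀ u v → (f u ≡ f v) ⇔ SameCycle u v)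
    × (∀ u v → QuotAdj u v ⇔
          (toℕ (f v) ≡ (toℕ (f u) + 1) % m ⊎ toℕ (f u) ≡ (toℕ (f v) + 1) % m))

  CycleQuotientType : (m : ℕ) → .{{NonZero m}} → Set
  CycleQuotientType m = QuotientIsCycle m

  Alternating : Set
  Alternating = ∀ v w o o' → inC F v w ≡ true → IsOutside v o → IsOutside w o' →
    ¬ SameCycle o o'

  AlternatingCycleQuotientType : (m : ℕ) → .{{NonZero m}} → Set
  AlternatingCycleQuotientType m = CycleQuotientType m × Alternating

  Preserves : Permutation′ N → Set
  Preserves σ = ∀ u v → SameCycle u v ⇔ SameCycle (σ ⟨$⟩ʳ u) (σ ⟨$⟩ʳ v)

  MemberIs4Cycle : Fin N → Set
  MemberIs4Cycle v = ∃[ a ] ∃[ b ] ∃[ c ]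
      (v ≢ a × v ≢ b × v ≢ c × a ≢ b × a ≢ c × b ≢ c)
    × (inC F v a ≡ true × inC F a b ≡ true × inC F b c ≡ true × inC F c v ≡ true)
    × (∀ w → SameCycle v w ⇔ (w ∈ v ∷ a ∷ b ∷ c ∷ []))

-- Honeycomb toroidal graph HTG(m,n,ℓ) on vertices u_{i,j} ≅ (i , j)

HTGArc : (m n ℓ : ℕ) → .{{NonZero n}} → Fin m × Fin n → Fin m × Fin n → Set
HTGArc m n ℓ (i , j) (i' , j') =
    (i ≡ i' × toℕ j' ≡ (toℕ j + 1) % n)
  ⊎ (suc (toℕ i) ≡ toℕ i' × j ≡ j' × toℕ j % 2 ≡ toℕ i % 2)
  ⊎ (suc (toℕ i) ≡ m × toℕ i' ≡ 0 × toℕ j % 2 ≡ toℕ i % 2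
       × toℕ j' ≡ (toℕ j + ℓ) % n)

HTGAdj : (m n ℓ : ℕ) → .{{NonZero n}} → Fin m × Fin n → Fin m × Fin n → Set
HTGAdj m n ℓ x y = HTGArc m n ℓ x y ⊎ HTGArc m n ℓ y x

IsoHTG : {N : ℕ} → SimpleGraph N → (m n ℓ : ℕ) → .{{NonZero n}} → Set
IsoHTG {N} Γ m n ℓ = Σ (Fin N ↔ (Fin m × Fin n)) λ φ →
  ∀ u v → adj Γ u v ≡ true ⇔ HTGAdj m n ℓ (Inverse.to φ u) (Inverse.to φ v)

module Submission where

-- Every vertex v has a unique outside neighbour out v.  A chord (out v on the 4-cycle of v) at
-- one vertex would, by the transitive group G preserving 𝒞, give chords everywhere, and then
-- the cycle through v would be all of the connected graph Γ.  So out v lies on the next or the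
-- previous cycle of Γ_𝒞 (v ascends or descends), and alternation makes the two ends of every
-- 𝒞-edge go opposite ways; hence out commutes with taking the opposite vertex on a 4-cycle.
-- Walking once around Γ_𝒞 from an ascending vertex, alternately through the outside edges
-- of positions 0,2 and 1,3, names every vertex by (cycle, position) as in HTG(m,4,ℓ); the
-- twist ℓ = m mod 2 records where the walk re-enters the first cycle.  Finally the 𝒞-edges
-- are exactly the edges of Γ lying on 4-cycles, so every automorphism preserves 𝒞.

open import Defs hiding (sym)
open import Data.Nat using (ℕ; NonZero; _%_; zero; suc; _+_; _∸_; _≤_; _<_; z≤n; s≤s)
open import Data.Nat.Properties
  using (+-comm; +-identityʳ; ∸-monoˡ-≤; suc-pred; suc-injective; n<1+n; <⇒≤; <⇒≢; ≤∧≢⇒<; <-irrefl; ≤-trans; ≤-reflexive)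
open import Data.Nat.DivMod using (m<n⇒m%n≡m; n%n≡0; m%n<n; m%n%n≡m%n)
open import Data.Fin using (Fin; toℕ; fromℕ<) renaming (zero to fz; suc to fs)
open import Data.Fin.Properties using (_≟_; toℕ-injective; toℕ<n; toℕ-fromℕ<)
open import Data.Bool using (Bool; true; false; if_then_else_; _∧_; not)
open import Data.Bool.Properties using (∧-identityʳ; not-involutive; not-¬; ¬-not)
open import Data.List using (List; _∷_; []; length; tabulate)
open import Data.List.Properties using (map-tabulate)
open import Data.Nat.ListAction using (sum)
open import Data.List.Relation.Unary.All using (All; []; _∷_)
open import Data.List.Relation.Unary.All.Properties.Core using (¬Any⇒All¬)
open import Data.List.Relation.Unary.AllPairs using ([]; _∷_)
open import Data.List.Relation.Unary.Unique.Propositional using (Unique)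
open import Data.List.Membership.Propositional using (_∈_)
open import Data.List.Relation.Unary.Any using (any?; here; there)
open import Data.Product using (∃; ∃-syntax; _×_; _,_; proj₁; proj₂)
open import Data.Sum as Sum using (_⊎_; inj₁; inj₂)
open import Function using (id; _∘_)
open import Function.Bundles using (Injection; Equivalence; mk⇔; mk↔ₛ′)
open import Function.Properties.Inverse using (↔⇒↣)
open import Data.Fin.Permutation using (Permutation′; _⟨$⟩ʳ_; _⟨$⟩ˡ_; inverseˡ; inverseʳ; flip)
open import Data.List.Relation.Unary.All as All using ()
open import Data.Empty using (⊥)
open import Relation.Nullary using (¬_; yes; no; does; contradiction)
open import Relation.Nullary.Decidable using (dec-true; dec-false)
open import Relation.Binary.PropositionalEquality
  using (_≡_; _≢_; refl; sym; trans; cong; cong₂; subst; subst₂; module ≡-Reasoning)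
open ≡-Reasoning

count : {N : ℕ} → (Fin N → Bool) → ℕ
count P = sum (tabulate (λ w → if P w then 1 else 0))

degreeOf≡count : {N : ℕ} (R : Fin N → Fin N → Bool) (v : Fin N) → degreeOf R v ≡ count (R v)
degreeOf≡count {N} R v = cong sum (map-tabulate id (λ w → if R v w then 1 else 0))

count-cong : {N : ℕ} {P Q : Fin N → Bool} → (∀ w → P w ≡ Q w) → count P ≡ count Q
count-cong {zero} eq = refl
count-cong {suc N} eq rewrite eq fz = cong (_ +_) (count-cong (eq ∘ fs))

count-remove : {N : ℕ} (P : Fin N → Bool) {a : Fin N} → P a ≡ true →
  count P ≡ suc (count (λ w → P w ∧ not (does (w ≟ a))))
count-remove {suc N} P {fz} Pa rewrite Pa =
  cong suc (count-cong (λ w → sym (∧-identityʳ (P (fs w)))))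
count-remove {suc N} P {fs a} Pa
  rewrite ∧-identityʳ (P fz) | count-remove (P ∘ fs) Pa with P fz
... | true = refl
... | false = refl

length≤count : {N : ℕ} (P : Fin N → Bool) {xs : List (Fin N)} →
  Unique xs → All (λ x → P x ≡ true) xs → length xs ≤ count P
length≤count P {[]} _ _ = z≤n
length≤count P {x ∷ xs} (x≢xs ∷ unique) (Px ∷ Pxs) rewrite count-remove P Px =
  s≤s (length≤count _ unique (remaining Pxs x≢xs))
  where
  remaining : ∀ {ys} → All (λ y → P y ≡ true) ys → All (x ≢_) ys →
    All (λ y → (P y ∧ not (does (y ≟ x))) ≡ true) ys
  remaining [] [] = []
  remaining (Py ∷ Pys) (x≢y ∷ x≢ys) =
    trans (cong₂ _∧_ Py (cong not (dec-false (_ ≟ x) (x≢y ∘ sym)))) refl ∷ remaining Pys x≢ys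

count≡suc⇒∃ : {N : ℕ} (P : Fin N → Bool) {k : ℕ} → count P ≡ suc k → ∃ λ w → P w ≡ true
count≡suc⇒∃ {suc N} P eq with P fz in Pz
... | true = fz , Pz
... | false with count≡suc⇒∃ (P ∘ fs) eq
...   | w , Pw = fs w , Pw

count-complete : {N : ℕ} (P : Fin N → Bool) {xs : List (Fin N)} →
  Unique xs → All (λ x → P x ≡ true) xs → count P ≡ length xs →
  ∀ {w} → P w ≡ true → w ∈ xs
count-complete P {xs} unique Pxs eq {w} Pw with any? (w ≟_) xs
... | yes w∈xs = w∈xs
... | no w∉xs = contradiction (length≤count P (¬Any⇒All¬ xs w∉xs ∷ unique) (Pw ∷ Pxs))
                  (λ le → <-irrefl refl (≤-trans le (≤-reflexive eq)))

Reach-trans : {N : ℕ} {R : Fin N → Fin N → Bool} {u v w : Fin N} →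
  Reach R u v → Reach R v w → Reach R u w
Reach-trans here r = r
Reach-trans (step e r) r′ = step e (Reach-trans r r′)

Reach-sym : {N : ℕ} {R : Fin N → Fin N → Bool} → (∀ u v → R u v ≡ R v u) →
  {u v : Fin N} → Reach R u v → Reach R v u
Reach-sym R-sym here = here
Reach-sym R-sym {u} (step {v = v} e r) = Reach-trans (Reach-sym R-sym r) (step (trans (R-sym v u) e) here)

Reach-closed : {N : ℕ} {R : Fin N → Fin N → Bool} (S : Fin N → Set) →
  (∀ {u v} → R u v ≡ true → S u → S v) → ∀ {u v} → S u → Reach R u v → S v
Reach-closed S closed Su here = Su
Reach-closed S closed Su (step e r) = Reach-closed S closed (closed e Su) r

Reach-map : {N : ℕ} {R R′ : Fin N → Fin N → Bool} (g : Fin N → Fin N) →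
  (∀ {u v} → R u v ≡ true → R′ (g u) (g v) ≡ true) → ∀ {u v} → Reach R u v → Reach R′ (g u) (g v)
Reach-map g hom here = here
Reach-map g hom (step e r) = step (hom e) (Reach-map g hom r)

permutation-injective : ∀ {N} (σ : Permutation′ N) {x y} → σ ⟨$⟩ʳ x ≡ σ ⟨$⟩ʳ y → x ≡ y
permutation-injective σ = Injection.injective (↔⇒↣ σ)

+1-mod-cases : ∀ a m .{{_ : NonZero m}} → a < m →
  (suc a ≡ m × (a + 1) % m ≡ 0) ⊎ (suc a < m × (a + 1) % m ≡ suc a)
+1-mod-cases a m a<m rewrite +-comm a 1 with suc a Data.Nat.≟ m
... | yes refl = inj₁ (refl , n%n≡0 (suc a))
... | no 1+a≢m = inj₂ (≤∧≢⇒< a<m 1+a≢m , m<n⇒m%n≡m (≤∧≢⇒< a<m 1+a≢m))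

+1-mod-injective : ∀ {a b} m .{{_ : NonZero m}} → a < m → b < m → (a + 1) % m ≡ (b + 1) % m → a ≡ b
+1-mod-injective {a} {b} m a<m b<m eq with +1-mod-cases a m a<m | +1-mod-cases b m b<m
... | inj₁ (a+1≡m , _) | inj₁ (b+1≡m , _) = suc-injective (trans a+1≡m (sym b+1≡m))
... | inj₁ (_ , a↦0) | inj₂ (_ , b↦b+1) = contradiction (trans (sym a↦0) (trans eq b↦b+1)) λ ()
... | inj₂ (_ , a↦a+1) | inj₁ (_ , b↦0) = contradiction (trans (sym a↦a+1) (trans eq b↦0)) λ ()
... | inj₂ (_ , a↦a+1) | inj₂ (_ , b↦b+1) = suc-injective (trans (sym a↦a+1) (trans eq b↦b+1))

+1-mod-asymmetric : ∀ {a b} m .{{_ : NonZero m}} → 3 ≤ m → a < m → b < m →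
  b ≡ (a + 1) % m → a ≡ (b + 1) % m → ⊥
+1-mod-asymmetric {a} m 3≤m a<m b<m refl a≡ with +1-mod-cases a m a<m
... | inj₁ (refl , a↦0)
  with trans a≡ (trans (cong (λ x → (x + 1) % m) a↦0) (m<n⇒m%n≡m (≤-trans (s≤s (s≤s z≤n)) 3≤m)))
...   | refl = contradiction 3≤m λ { (s≤s (s≤s ())) }
+1-mod-asymmetric {a} m 3≤m a<m b<m refl a≡ | inj₂ (a+1<m , a↦a+1)
  with +1-mod-cases (suc a) m a+1<m
... | inj₁ (refl , a+1↦0) with trans a≡ (trans (cong (λ x → (x + 1) % m) a↦a+1) a+1↦0)
...   | refl = contradiction 3≤m λ { (s≤s (s≤s ())) }
+1-mod-asymmetric {a} m 3≤m a<m b<m refl a≡ | inj₂ (a+1<m , a↦a+1) | inj₂ (_ , a+1↦a+2) =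
  contradiction (trans a≡ (trans (cong (λ x → (x + 1) % m) a↦a+1) a+1↦a+2)) (n≢2+n a)
  where
  n≢2+n : ∀ n → n ≢ suc (suc n)
  n≢2+n zero ()
  n≢2+n (suc n) eq = n≢2+n n (suc-injective eq)

even : ℕ → Bool
even zero = true
even (suc n) = not (even n)

parity : ∀ n → (n % 2 ≡ 0 × even n ≡ true) ⊎ (n % 2 ≡ 1 × even n ≡ false)
parity zero = inj₁ (refl , refl)
parity (suc zero) = inj₂ (refl , refl)
parity (suc (suc n)) rewrite not-involutive (even n) = parity n

parity-suc : ∀ n →
  (n % 2 ≡ 0 × suc n % 2 ≡ 1 × even n ≡ true) ⊎ (n % 2 ≡ 1 × suc n % 2 ≡ 0 × even n ≡ false)
parity-suc zero = inj₁ (refl , refl , refl)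
parity-suc (suc zero) = inj₂ (refl , refl , refl)
parity-suc (suc (suc n)) rewrite not-involutive (even n) = parity-suc n

even-agreement : ∀ i j → (if even j then even i else not (even i)) ≡ does (j % 2 Data.Nat.≟ i % 2)
even-agreement i j with parity i | parity j
... | inj₁ (i0 , ei) | inj₁ (j0 , ej) rewrite i0 | j0 | ei | ej = refl
... | inj₁ (i0 , ei) | inj₂ (j1 , ej) rewrite i0 | j1 | ei | ej = refl
... | inj₂ (i1 , ei) | inj₁ (j0 , ej) rewrite i1 | j0 | ei | ej = refl
... | inj₂ (i1 , ei) | inj₂ (j1 , ej) rewrite i1 | j1 | ei | ej = refl

module Factorisation {N : ℕ} {Γ : SimpleGraph N} (F : TwoOneFactorisation Γ) where

  Adj CEdge : Fin N → Fin N → Set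
  Adj u v = adj Γ u v ≡ true
  CEdge u v = inC F u v ≡ true

  Adj-sym : ∀ {u v} → Adj u v → Adj v u
  Adj-sym {u} {v} = trans (SimpleGraph.sym Γ v u)

  CEdge-sym : ∀ {u v} → CEdge u v → CEdge v u
  CEdge-sym {u} {v} = trans (C-sym F v u)

  CEdge⇒Adj : ∀ {u v} → CEdge u v → Adj u v
  CEdge⇒Adj = C⊆E F _ _

  CEdge⇒SameCycle : ∀ {u v} → CEdge u v → SameCycle F u v
  CEdge⇒SameCycle e = step e here

  SameCycle-sym : ∀ {u v} → SameCycle F u v → SameCycle F v u
  SameCycle-sym = Reach-sym (C-sym F)

  CEdge-third : ∀ {x y z w} → CEdge x y → CEdge x z → y ≢ z → CEdge x w → w ≡ y ⊎ w ≡ z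
  CEdge-third {x} xy xz y≢z xw
    with count-complete (inC F x) ((y≢z ∷ []) ∷ [] ∷ []) (xy ∷ xz ∷ [])
           (trans (sym (degreeOf≡count (inC F) x)) (C-2reg F x)) xw
  ... | here w≡y = inj₁ w≡y
  ... | there (here w≡z) = inj₂ w≡z

  private
    outside? : Fin N → Fin N → Bool
    outside? u w = adj Γ u w ∧ not (inC F u w)

    outside?⇒IsOutside : ∀ {u w} → outside? u w ≡ true → IsOutside F u w
    outside?⇒IsOutside {u} {w} eq with adj Γ u w | inC F u w
    ... | true | false = refl , refl

    IsOutside⇒outside? : ∀ {u w} → IsOutside F u w → outside? u w ≡ true
    IsOutside⇒outside? (uw , notC) rewrite uw | notC = refl

    outside-count : ∀ v → count (outside? v) ≡ 1
    outside-count v = trans (sym (degreeOf≡count outside? v)) (I-1reg F v)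

  out : Fin N → Fin N
  out v = proj₁ (count≡suc⇒∃ (outside? v) (outside-count v))

  out-IsOutside : ∀ v → IsOutside F v (out v)
  out-IsOutside v = outside?⇒IsOutside (proj₂ (count≡suc⇒∃ (outside? v) (outside-count v)))

  out-Adj : ∀ v → Adj v (out v)
  out-Adj v = proj₁ (out-IsOutside v)

  out-unique : ∀ {v w} → IsOutside F v w → w ≡ out v
  out-unique {v} vw
    with count-complete (outside? v) ([] ∷ []) (IsOutside⇒outside? (out-IsOutside v) ∷ [])
           (outside-count v) (IsOutside⇒outside? vw)
  ... | here w≡out = w≡out

  Adj⇒CEdge⊎out : ∀ {v w} → Adj v w → CEdge v w ⊎ w ≡ out v
  Adj⇒CEdge⊎out {v} {w} vw with inC F v w in vwC
  ... | true = inj₁ refl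
  ... | false = inj₂ (out-unique (vw , vwC))

  out-involutive : ∀ v → out (out v) ≡ v
  out-involutive v with out-IsOutside v
  ... | v~out , notC = sym (out-unique (Adj-sym v~out , trans (C-sym F (out v) v) notC))

  out-injective : ∀ {u v} → out u ≡ out v → u ≡ v
  out-injective {u} {v} eq = trans (sym (out-involutive u)) (trans (cong out eq) (out-involutive v))

  CEdge⇒≢out : ∀ {v w} → CEdge v w → out v ≢ w
  CEdge⇒≢out {v} vw refl = contradiction (trans (sym vw) (proj₂ (out-IsOutside v))) λ ()

pattern at₀ = here refl
pattern at₁ = there (here refl)
pattern at₂ = there (there (here refl))
pattern at₃ = there (there (there (here refl)))

next prev : Fin 4 → Fin 4
next fz = fs fz
next (fs fz) = fs (fs fz)
next (fs (fs fz)) = fs (fs (fs fz))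
next (fs (fs (fs fz))) = fz
prev fz = fs (fs (fs fz))
prev (fs fz) = fz
prev (fs (fs fz)) = fs fz
prev (fs (fs (fs fz))) = fs (fs fz)

toℕ-next : ∀ j → toℕ (next j) ≡ (toℕ j + 1) % 4
toℕ-next fz = refl
toℕ-next (fs fz) = refl
toℕ-next (fs (fs fz)) = refl
toℕ-next (fs (fs (fs fz))) = refl

toℕ-prev : ∀ j → toℕ j ≡ (toℕ (prev j) + 1) % 4
toℕ-prev fz = refl
toℕ-prev (fs fz) = refl
toℕ-prev (fs (fs fz)) = refl
toℕ-prev (fs (fs (fs fz))) = refl

module Squares {N : ℕ} {Γ : SimpleGraph N} (F : TwoOneFactorisation Γ)
    (squares : ∀ v → MemberIs4Cycle F v) where

  open Factorisation F

  record Square (w₀ w₁ w₂ w₃ : Fin N) : Set where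
    field
      e₀₁ : CEdge w₀ w₁
      e₁₂ : CEdge w₁ w₂
      e₂₃ : CEdge w₂ w₃
      e₃₀ : CEdge w₃ w₀
      d₀₁ : w₀ ≢ w₁
      d₀₂ : w₀ ≢ w₂
      d₀₃ : w₀ ≢ w₃
      d₁₂ : w₁ ≢ w₂
      d₁₃ : w₁ ≢ w₃
      d₂₃ : w₂ ≢ w₃

  rotate : ∀ {w₀ w₁ w₂ w₃} → Square w₀ w₁ w₂ w₃ → Square w₁ w₂ w₃ w₀
  rotate K = record
    { e₀₁ = e₁₂ ; e₁₂ = e₂₃ ; e₂₃ = e₃₀ ; e₃₀ = e₀₁
    ; d₀₁ = d₁₂ ; d₀₂ = d₁₃ ; d₀₃ = d₀₁ ∘ sym ; d₁₂ = d₂₃ ; d₁₃ = d₀₂ ∘ sym ; d₂₃ = d₀₃ ∘ sym }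
    where open Square K

  reflect : ∀ {w₀ w₁ w₂ w₃} → Square w₀ w₁ w₂ w₃ → Square w₀ w₃ w₂ w₁
  reflect K = record
    { e₀₁ = CEdge-sym e₃₀ ; e₁₂ = CEdge-sym e₂₃ ; e₂₃ = CEdge-sym e₁₂ ; e₃₀ = CEdge-sym e₀₁
    ; d₀₁ = d₀₃ ; d₀₂ = d₀₂ ; d₀₃ = d₀₁ ; d₁₂ = d₂₃ ∘ sym ; d₁₃ = d₁₃ ∘ sym ; d₂₃ = d₁₂ ∘ sym }
    where open Square K

  -- Each vertex of a square already has both of its 𝒞-neighbours in the square.
  Square-members : ∀ {w₀ w₁ w₂ w₃ x} → Square w₀ w₁ w₂ w₃ → SameCycle F w₀ x →
    x ∈ w₀ ∷ w₁ ∷ w₂ ∷ w₃ ∷ []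
  Square-members {w₀} {w₁} {w₂} {w₃} K = Reach-closed (_∈ ws) closed at₀
    where
    open Square K
    ws : List (Fin N)
    ws = w₀ ∷ w₁ ∷ w₂ ∷ w₃ ∷ []
    either : ∀ {y a b} → y ≡ a ⊎ y ≡ b → a ∈ ws → b ∈ ws → y ∈ ws
    either (inj₁ refl) a∈ _ = a∈
    either (inj₂ refl) _ b∈ = b∈
    closed : ∀ {x y} → CEdge x y → x ∈ ws → y ∈ ws
    closed xy at₀ = either (CEdge-third e₀₁ (CEdge-sym e₃₀) d₁₃ xy) at₁ at₃
    closed xy at₁ = either (CEdge-third e₁₂ (CEdge-sym e₀₁) (d₀₂ ∘ sym) xy) at₂ at₀
    closed xy at₂ = either (CEdge-third e₂₃ (CEdge-sym e₁₂) (d₁₃ ∘ sym) xy) at₃ at₁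
    closed xy at₃ = either (CEdge-third e₃₀ (CEdge-sym e₂₃) d₀₂ xy) at₀ at₂

  nbr₁ opp nbr₃ : Fin N → Fin N
  nbr₁ v = proj₁ (squares v)
  opp v = proj₁ (proj₂ (squares v))
  nbr₃ v = proj₁ (proj₂ (proj₂ (squares v)))

  square-at : ∀ v → Square v (nbr₁ v) (opp v) (nbr₃ v)
  square-at v with squares v
  ... | _ , _ , _ , (d₀₁ , d₀₂ , d₀₃ , d₁₂ , d₁₃ , d₂₃) , (e₀₁ , e₁₂ , e₂₃ , e₃₀) , _ = record
    { e₀₁ = e₀₁ ; e₁₂ = e₁₂ ; e₂₃ = e₂₃ ; e₃₀ = e₃₀
    ; d₀₁ = d₀₁ ; d₀₂ = d₀₂ ; d₀₃ = d₀₃ ; d₁₂ = d₁₂ ; d₁₃ = d₁₃ ; d₂₃ = d₂₃ }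

  SameCycle-opp : ∀ v → SameCycle F v (opp v)
  SameCycle-opp v = step e₀₁ (CEdge⇒SameCycle e₁₂) where open Square (square-at v)

  ¬CEdge-opp : ∀ v → ¬ CEdge v (opp v)
  ¬CEdge-opp v e with CEdge-third e₀₁ (CEdge-sym e₃₀) d₁₃ e where open Square (square-at v)
  ... | inj₁ eq = Square.d₁₂ (square-at v) (sym eq)
  ... | inj₂ eq = Square.d₂₃ (square-at v) eq

  Square-opp : ∀ {w₀ w₁ w₂ w₃} → Square w₀ w₁ w₂ w₃ → opp w₀ ≡ w₂
  Square-opp {w₀} K with Square-members K (SameCycle-opp w₀)
  ... | here eq = contradiction (sym eq) (Square.d₀₂ (square-at w₀))
  ... | at₁ = contradiction (Square.e₀₁ K) (¬CEdge-opp w₀)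
  ... | there (there (here eq)) = eq
  ... | at₃ = contradiction (CEdge-sym (Square.e₃₀ K)) (¬CEdge-opp w₀)

  Square-on : ∀ {p q} → CEdge p q → Square p q (opp p) (opp q)
  Square-on {p} pq with CEdge-third e₀₁ (CEdge-sym e₃₀) d₁₃ pq where open Square (square-at p)
  ... | inj₁ refl rewrite Square-opp (rotate (square-at p)) = square-at p
  ... | inj₂ refl rewrite Square-opp (rotate (reflect (square-at p))) = reflect (square-at p)

  corners : Fin N → Fin N → Fin N → Fin N → Fin 4 → Fin N
  corners w₀ w₁ w₂ w₃ fz = w₀
  corners w₀ w₁ w₂ w₃ (fs fz) = w₁
  corners w₀ w₁ w₂ w₃ (fs (fs fz)) = w₂
  corners w₀ w₁ w₂ w₃ (fs (fs (fs fz))) = w₃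

  module Corners {w₀ w₁ w₂ w₃ : Fin N} (K : Square w₀ w₁ w₂ w₃) where
    open Square K

    corner : Fin 4 → Fin N
    corner = corners w₀ w₁ w₂ w₃

    corner-CEdge : ∀ j → CEdge (corner j) (corner (next j))
    corner-CEdge fz = e₀₁
    corner-CEdge (fs fz) = e₁₂
    corner-CEdge (fs (fs fz)) = e₂₃
    corner-CEdge (fs (fs (fs fz))) = e₃₀

    corner-neighbours : ∀ j {x} → CEdge (corner j) x → x ≡ corner (next j) ⊎ x ≡ corner (prev j)
    corner-neighbours fz = CEdge-third e₀₁ (CEdge-sym e₃₀) d₁₃
    corner-neighbours (fs fz) = CEdge-third e₁₂ (CEdge-sym e₀₁) (d₀₂ ∘ sym)
    corner-neighbours (fs (fs fz)) = CEdge-third e₂₃ (CEdge-sym e₁₂) (d₁₃ ∘ sym)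
    corner-neighbours (fs (fs (fs fz))) = CEdge-third e₃₀ (CEdge-sym e₂₃) d₀₂

    corner-SameCycle : ∀ j → SameCycle F w₀ (corner j)
    corner-SameCycle fz = here
    corner-SameCycle (fs fz) = CEdge⇒SameCycle e₀₁
    corner-SameCycle (fs (fs fz)) = step e₀₁ (CEdge⇒SameCycle e₁₂)
    corner-SameCycle (fs (fs (fs fz))) = CEdge⇒SameCycle (CEdge-sym e₃₀)

    corner-onto : ∀ {x} → SameCycle F w₀ x → ∃ λ j → corner j ≡ x
    corner-onto s with Square-members K s
    ... | at₀ = fz , refl
    ... | at₁ = fs fz , refl
    ... | at₂ = fs (fs fz) , refl
    ... | at₃ = fs (fs (fs fz)) , refl

    corner-injective : ∀ j j′ → corner j ≡ corner j′ → j ≡ j′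
    corner-injective fz fz _ = refl
    corner-injective fz (fs fz) eq = contradiction eq d₀₁
    corner-injective fz (fs (fs fz)) eq = contradiction eq d₀₂
    corner-injective fz (fs (fs (fs fz))) eq = contradiction eq d₀₃
    corner-injective (fs fz) fz eq = contradiction (sym eq) d₀₁
    corner-injective (fs fz) (fs fz) _ = refl
    corner-injective (fs fz) (fs (fs fz)) eq = contradiction eq d₁₂
    corner-injective (fs fz) (fs (fs (fs fz))) eq = contradiction eq d₁₃
    corner-injective (fs (fs fz)) fz eq = contradiction (sym eq) d₀₂
    corner-injective (fs (fs fz)) (fs fz) eq = contradiction (sym eq) d₁₂
    corner-injective (fs (fs fz)) (fs (fs fz)) _ = refl
    corner-injective (fs (fs fz)) (fs (fs (fs fz))) eq = contradiction eq d₂₃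
    corner-injective (fs (fs (fs fz))) fz eq = contradiction (sym eq) d₀₃
    corner-injective (fs (fs (fs fz))) (fs fz) eq = contradiction (sym eq) d₁₃
    corner-injective (fs (fs (fs fz))) (fs (fs fz)) eq = contradiction (sym eq) d₂₃
    corner-injective (fs (fs (fs fz))) (fs (fs (fs fz))) _ = refl

module OutsideEdges {N : ℕ} {Γ : SimpleGraph N} (connected : Connected Γ) (cubic : Cubic Γ)
    (F : TwoOneFactorisation Γ) (squares : ∀ v → MemberIs4Cycle F v)
    (G : Permutation′ N → Set) (G≤Aut : IsAutSubgroup Γ G) (G-transitive : TransitiveOn G)
    (G-preserves : ∀ σ → G σ → Preserves F σ) where

  open Factorisation F
  open Squares F squares

  Chord : Fin N → Set
  Chord v = SameCycle F v (out v)

  -- Γ being cubic, the images of the three neighbours of v are all the neighbours of σ v,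
  -- and all of them lie on its cycle.
  Chord-image : ∀ σ → G σ → ∀ {v} → Chord v → Chord (σ ⟨$⟩ʳ v)
  Chord-image σ Gσ {v} chord =
    All.lookup {P = SameCycle F (σ ⟨$⟩ʳ v)}
      (along (CEdge⇒SameCycle e₀₁) ∷ along (CEdge⇒SameCycle (CEdge-sym e₃₀)) ∷ along chord ∷ [])
      (count-complete (adj Γ (σ ⟨$⟩ʳ v)) distinct
        (image (CEdge⇒Adj e₀₁) ∷ image (CEdge⇒Adj (CEdge-sym e₃₀)) ∷ image (out-Adj v) ∷ [])
        (trans (sym (degreeOf≡count (adj Γ) _)) (cubic _)) (out-Adj _))
    where
    open Square (square-at v)
    σ-≢ : ∀ {x y} → x ≢ y → σ ⟨$⟩ʳ x ≢ σ ⟨$⟩ʳ y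
    σ-≢ x≢y = x≢y ∘ permutation-injective σ
    distinct : Unique ((σ ⟨$⟩ʳ nbr₁ v) ∷ (σ ⟨$⟩ʳ nbr₃ v) ∷ (σ ⟨$⟩ʳ out v) ∷ [])
    distinct = (σ-≢ d₁₃ ∷ σ-≢ (CEdge⇒≢out e₀₁ ∘ sym) ∷ [])
             ∷ (σ-≢ (CEdge⇒≢out (CEdge-sym e₃₀) ∘ sym) ∷ []) ∷ [] ∷ []
    image : ∀ {x} → Adj v x → Adj (σ ⟨$⟩ʳ v) (σ ⟨$⟩ʳ x)
    image = trans (IsAutSubgroup.⊆Aut G≤Aut σ Gσ v _)
    along : ∀ {x} → SameCycle F v x → SameCycle F (σ ⟨$⟩ʳ v) (σ ⟨$⟩ʳ x)
    along = Equivalence.to (G-preserves σ Gσ v _)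

  Chord-everywhere : ∀ {v} → Chord v → ∀ w → Chord w
  Chord-everywhere {v} chord w with G-transitive v w
  ... | σ , Gσ , refl = Chord-image σ Gσ chord

  -- With a chord at every vertex, the cycle through v is closed under adjacency.
  Chord⇒one-cycle : ∀ {v} → Chord v → ∀ w → SameCycle F v w
  Chord⇒one-cycle {v} chord w = Reach-closed (SameCycle F v) closed here (connected v w)
    where
    closed : ∀ {x y} → Adj x y → SameCycle F v x → SameCycle F v y
    closed xy vx with Adj⇒CEdge⊎out xy
    ... | inj₁ e = Reach-trans vx (CEdge⇒SameCycle e)
    ... | inj₂ refl = Reach-trans vx (Chord-everywhere chord _)

  no-chord : ∀ {u v} → ¬ SameCycle F u v → ∀ w → ¬ Chord w
  no-chord {u} {v} u≁v w chord =
    u≁v (Reach-trans (SameCycle-sym (Chord⇒one-cycle chord u)) (Chord⇒one-cycle chord v))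

module Sides {N : ℕ} {Γ : SimpleGraph N} (F : TwoOneFactorisation Γ)
    (squares : ∀ v → MemberIs4Cycle F v)
    (m : ℕ) .{{_ : NonZero m}} (quotient : QuotientIsCycle F m) (alternating : Alternating F)
    (out-leaves : ∀ v → ¬ SameCycle F v (Factorisation.out F v)) where

  open Factorisation F
  open Squares F squares

  3≤m : 3 ≤ m
  3≤m = proj₁ quotient

  label : Fin N → Fin m
  label = proj₁ (proj₂ quotient)

  label-onto : ∀ a → ∃ λ v → label v ≡ a
  label-onto = proj₁ (proj₂ (proj₂ quotient))

  label⇒SameCycle : ∀ {u v} → label u ≡ label v → SameCycle F u v
  label⇒SameCycle = Equivalence.to (proj₁ (proj₂ (proj₂ (proj₂ quotient))) _ _)

  SameCycle⇒label : ∀ {u v} → SameCycle F u v → label u ≡ label v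
  SameCycle⇒label = Equivalence.from (proj₁ (proj₂ (proj₂ (proj₂ quotient))) _ _)

  label-CEdge : ∀ {u v} → CEdge u v → toℕ (label u) ≡ toℕ (label v)
  label-CEdge = cong toℕ ∘ SameCycle⇒label ∘ CEdge⇒SameCycle

  Ascends Descends : Fin N → Set
  Ascends v = toℕ (label (out v)) ≡ (toℕ (label v) + 1) % m
  Descends v = toℕ (label v) ≡ (toℕ (label (out v)) + 1) % m

  ascends-or-descends : ∀ v → Ascends v ⊎ Descends v
  ascends-or-descends v = Equivalence.to (proj₂ (proj₂ (proj₂ (proj₂ quotient))) v (out v))
    (out-leaves v , v , out v , here , here , out-Adj v)

  ascends? : Fin N → Bool
  ascends? v = does (toℕ (label (out v)) Data.Nat.≟ (toℕ (label v) + 1) % m)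

  Ascends⇒ascends? : ∀ {v} → Ascends v → ascends? v ≡ true
  Ascends⇒ascends? = dec-true (_ Data.Nat.≟ _)

  Descends⇒ascends? : ∀ {v} → Descends v → ascends? v ≡ false
  Descends⇒ascends? desc = dec-false (_ Data.Nat.≟ _) λ asc →
    +1-mod-asymmetric m 3≤m (toℕ<n _) (toℕ<n _) asc desc

  ascends?⇒Ascends : ∀ {v} → ascends? v ≡ true → Ascends v
  ascends?⇒Ascends {v} eq with ascends-or-descends v
  ... | inj₁ asc = asc
  ... | inj₂ desc = contradiction (trans (sym eq) (Descends⇒ascends? desc)) λ ()

  ascends?⇒Descends : ∀ {v} → ascends? v ≡ false → Descends v
  ascends?⇒Descends {v} eq with ascends-or-descends v
  ... | inj₁ asc = contradiction (trans (sym (Ascends⇒ascends? asc)) eq) λ ()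
  ... | inj₂ desc = desc

  ascends?-out : ∀ v → ascends? (out v) ≡ not (ascends? v)
  ascends?-out v with ascends-or-descends v
  ... | inj₁ asc rewrite Ascends⇒ascends? asc =
    Descends⇒ascends? (subst (λ x → toℕ (label (out v)) ≡ (toℕ (label x) + 1) % m)
                               (sym (out-involutive v)) asc)
  ... | inj₂ desc rewrite Descends⇒ascends? desc =
    Ascends⇒ascends? (subst (λ x → toℕ (label x) ≡ (toℕ (label (out v)) + 1) % m)
                              (sym (out-involutive v)) desc)

  label-out : ∀ {x y} → label x ≡ label y → ascends? x ≡ ascends? y → label (out x) ≡ label (out y)
  label-out {x} {y} xy same with ascends-or-descends x
  ... | inj₁ asc = toℕ-injective (begin
    toℕ (label (out x))          ≡⟨ asc ⟩
    (toℕ (label x) + 1) % m      ≡⟨ cong (λ a → (toℕ a + 1) % m) xy ⟩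
    (toℕ (label y) + 1) % m      ≡⟨ sym (ascends?⇒Ascends (trans (sym same) (Ascends⇒ascends? asc))) ⟩
    toℕ (label (out y))          ∎)
  ... | inj₂ desc = toℕ-injective (+1-mod-injective m (toℕ<n _) (toℕ<n _) (begin
    (toℕ (label (out x)) + 1) % m  ≡⟨ sym desc ⟩
    toℕ (label x)                  ≡⟨ cong toℕ xy ⟩
    toℕ (label y)                  ≡⟨ ascends?⇒Descends (trans (sym same) (Descends⇒ascends? desc)) ⟩
    (toℕ (label (out y)) + 1) % m  ∎))

  -- This is where alternation is used.
  ascends?-CEdge : ∀ {u w} → CEdge u w → ascends? w ≡ not (ascends? u)
  ascends?-CEdge {u} {w} uw = ¬-not λ same →
    alternating u w (out u) (out w) uw (out-IsOutside u) (out-IsOutside w)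
      (label⇒SameCycle (label-out (SameCycle⇒label (CEdge⇒SameCycle uw)) (sym same)))

  ascends?-opp : ∀ u → ascends? (opp u) ≡ ascends? u
  ascends?-opp u = begin
    ascends? (opp u)             ≡⟨ ascends?-CEdge e₁₂ ⟩
    not (ascends? (nbr₁ u))      ≡⟨ cong not (ascends?-CEdge e₀₁) ⟩
    not (not (ascends? u))       ≡⟨ not-involutive _ ⟩
    ascends? u                   ∎
    where open Square (square-at u)

  ascends?-out-opp : ∀ x → ascends? (out (opp x)) ≡ ascends? (out x)
  ascends?-out-opp x =
    trans (ascends?-out (opp x)) (trans (cong not (ascends?-opp x)) (sym (ascends?-out x)))

  out-opp : ∀ x → out (opp x) ≡ opp (out x)
  out-opp x with Square-members (square-at (out x))
                   (label⇒SameCycle (label-out (SameCycle⇒label (SameCycle-opp x)) (sym (ascends?-opp x))))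
  ... | here eq = contradiction (out-injective eq) (Square.d₀₂ (square-at x) ∘ sym)
  ... | there (here eq) =
    contradiction (trans (cong ascends? eq) (ascends?-CEdge (Square.e₀₁ (square-at (out x)))))
      (not-¬ (ascends?-out-opp x))
  ... | there (there (here eq)) = eq
  ... | there (there (there (here eq))) =
    contradiction (trans (cong ascends? eq) (ascends?-CEdge (CEdge-sym (Square.e₃₀ (square-at (out x))))))
      (not-¬ (ascends?-out-opp x))

  ascends?-corner : ∀ {p q} → CEdge p q → ∀ j →
    ascends? (corners p q (opp p) (opp q) j) ≡ (if even (toℕ j) then ascends? p else not (ascends? p))
  ascends?-corner pq fz = refl
  ascends?-corner pq (fs fz) = ascends?-CEdge pq
  ascends?-corner {p} pq (fs (fs fz)) = ascends?-opp p
  ascends?-corner {p} {q} pq (fs (fs (fs fz))) = trans (ascends?-opp q) (ascends?-CEdge pq)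

module Coordinates {N : ℕ} {Γ : SimpleGraph N} (F : TwoOneFactorisation Γ)
    (squares : ∀ v → MemberIs4Cycle F v)
    (m : ℕ) .{{_ : NonZero m}} (quotient : QuotientIsCycle F m) (alternating : Alternating F)
    (out-leaves : ∀ v → ¬ SameCycle F v (Factorisation.out F v)) where

  open Factorisation F
  open Squares F squares
  open Sides F squares m quotient alternating out-leaves

  0<m : 0 < m
  0<m = ≤-trans (s≤s z≤n) 3≤m

  label-zero : Fin m
  label-zero = fromℕ< 0<m

  start : ∃ λ v → ascends? v ≡ true × toℕ (label v) ≡ 0
  start with label-onto label-zero
  ... | z , lz with ascends? z in az
  ...   | true = z , az , trans (cong toℕ lz) (toℕ-fromℕ< 0<m)
  ...   | false = nbr₁ z , trans (ascends?-CEdge z₀₁) (cong not az) ,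
                  trans (sym (label-CEdge z₀₁)) (trans (cong toℕ lz) (toℕ-fromℕ< 0<m))
    where
    z₀₁ : CEdge z (nbr₁ z)
    z₀₁ = Square.e₀₁ (square-at z)

  v₀ : Fin N
  v₀ = proj₁ start

  -- A frame (p , q) of cycle i is a 𝒞-edge whose ascending end sits at position i mod 2.
  Framed : ℕ → Fin N × Fin N → Set
  Framed i (p , q) = CEdge p q × toℕ (label p) ≡ i × ascends? p ≡ even i

  advance : Bool → Fin N × Fin N → Fin N × Fin N
  advance true (p , q) = out p , nbr₁ (out p)
  advance false (p , q) = nbr₁ (out q) , out q

  label-out-ascending : ∀ {u i} → ascends? u ≡ true → toℕ (label u) ≡ i → suc i < m →
    toℕ (label (out u)) ≡ suc i
  label-out-ascending {u} {i} asc lu i+1<m with +1-mod-cases i m (<⇒≤ i+1<m)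
  ... | inj₁ (i+1≡m , _) = contradiction i+1≡m (<⇒≢ i+1<m)
  ... | inj₂ (_ , i↦i+1) = trans (ascends?⇒Ascends asc) (trans (cong (λ a → (a + 1) % m) lu) i↦i+1)

  advance-Framed : ∀ {i} pq → Framed i pq → suc i < m → Framed (suc i) (advance (even i) pq)
  advance-Framed {i} (p , q) (pq , lp , ap) i+1<m with even i
  ... | true = Square.e₀₁ (square-at (out p)) , label-out-ascending ap lp i+1<m ,
               trans (ascends?-out p) (cong not ap)
  ... | false = CEdge-sym q₀₁ ,
                trans (label-CEdge (CEdge-sym q₀₁))
                  (label-out-ascending aq (trans (sym (label-CEdge pq)) lp) i+1<m) ,
                trans (ascends?-CEdge q₀₁) (trans (cong not (ascends?-out q)) (trans (not-involutive _) aq))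
    where
    q₀₁ : CEdge (out q) (nbr₁ (out q))
    q₀₁ = Square.e₀₁ (square-at (out q))
    aq : ascends? q ≡ true
    aq = trans (ascends?-CEdge pq) (cong not ap)

  provisional-frame : ℕ → Fin N × Fin N
  provisional-frame zero = v₀ , nbr₁ v₀
  provisional-frame (suc i) = advance (even i) (provisional-frame i)

  provisional-Framed : ∀ i → i < m → Framed i (provisional-frame i)
  provisional-Framed zero _ = Square.e₀₁ (square-at v₀) , proj₂ (proj₂ start) , proj₁ (proj₂ start)
  provisional-Framed (suc i) i+1<m =
    advance-Framed (provisional-frame i) (provisional-Framed i (<⇒≤ i+1<m)) i+1<m

  k : ℕ
  k = m ∸ 1

  1+k≡m : suc k ≡ m
  1+k≡m = suc-pred m

  k<m : k < m
  k<m = subst (k <_) 1+k≡m (n<1+n k)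

  0<k : 0 < k
  0<k = ≤-trans (s≤s z≤n) (∸-monoˡ-≤ 1 3≤m)

  ascending-end : ℕ → Fin N × Fin N → Fin N
  ascending-end i (p , q) = if even i then p else q

  last-frame : Fin N × Fin N
  last-frame = provisional-frame k

  closing : Fin N
  closing = out (ascending-end k last-frame)

  -- Only the first vertex of frame 0 is read by advance, so fixing its second vertex to
  -- the closing vertex leaves all later frames unchanged.
  frame : ℕ → Fin N × Fin N
  frame zero = v₀ , closing
  frame (suc i) = provisional-frame (suc i)

  frame-advance : ∀ i → frame (suc i) ≡ advance (even i) (frame i)
  frame-advance zero = refl
  frame-advance (suc i) = refl

  ascending-end-ascends : ∀ {i} pq → Framed i pq →
    ascends? (ascending-end i pq) ≡ true × toℕ (label (ascending-end i pq)) ≡ i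
  ascending-end-ascends {i} (p , q) (pq , lp , ap) with even i
  ... | true = ap , lp
  ... | false = trans (ascends?-CEdge pq) (cong not ap) ,
                trans (sym (label-CEdge pq)) lp

  last-Framed : Framed k last-frame
  last-Framed = provisional-Framed k k<m

  closing-label : toℕ (label closing) ≡ 0
  closing-label with ascending-end-ascends _ (last-Framed) | +1-mod-cases k m k<m
  ... | asc , lk | inj₁ (_ , k↦0) = trans (ascends?⇒Ascends asc) (trans (cong (λ a → (a + 1) % m) lk) k↦0)
  ... | _ | inj₂ (k+1<m , _) = contradiction 1+k≡m (<⇒≢ k+1<m)

  closing-descends : ascends? closing ≡ false
  closing-descends = trans (ascends?-out _) (cong not (proj₁ (ascending-end-ascends _ (last-Framed))))

  v₀-closing : CEdge v₀ closing
  v₀-closing with Square-members (square-at v₀)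
                    (label⇒SameCycle (toℕ-injective (trans (proj₂ (proj₂ start)) (sym closing-label))))
  ... | here eq =
    contradiction (trans (sym (proj₁ (proj₂ start))) (trans (cong ascends? (sym eq)) closing-descends)) λ ()
  ... | there (here eq) = subst (CEdge v₀) (sym eq) (Square.e₀₁ (square-at v₀))
  ... | there (there (here eq)) =
    contradiction (trans (sym (proj₁ (proj₂ start)))
                    (trans (sym (ascends?-opp v₀)) (trans (cong ascends? (sym eq)) closing-descends))) λ ()
  ... | there (there (there (here eq))) = subst (CEdge v₀) (sym eq) (CEdge-sym (Square.e₃₀ (square-at v₀)))

  frame-Framed : ∀ i → i < m → Framed i (frame i)
  frame-Framed zero _ = v₀-closing , proj₂ (proj₂ start) , proj₁ (proj₂ start)
  frame-Framed (suc i) = provisional-Framed (suc i)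

  frame-last : frame k ≡ last-frame
  frame-last = frame-positive k 0<k
    where
    frame-positive : ∀ i → 0 < i → frame i ≡ provisional-frame i
    frame-positive (suc i) _ = refl

  cornersOf : Fin N × Fin N → Fin 4 → Fin N
  cornersOf (p , q) = corners p q (opp p) (opp q)

  vertexAt : ℕ → Fin 4 → Fin N
  vertexAt i = cornersOf (frame i)

  out-vertexAt-suc : ∀ {i} j → suc i < m → toℕ j % 2 ≡ i % 2 → out (vertexAt i j) ≡ vertexAt (suc i) j
  out-vertexAt-suc {i} j i+1<m jᵢ rewrite frame-advance i with parity i
  ... | inj₁ (i0 , ei) rewrite i0 | ei = even-corner j jᵢ
    where
    even-corner : ∀ j → toℕ j % 2 ≡ 0 → out (cornersOf (frame i) j) ≡ cornersOf (advance true (frame i)) j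
    even-corner fz _ = refl
    even-corner (fs fz) ()
    even-corner (fs (fs fz)) _ = out-opp _
    even-corner (fs (fs (fs fz))) ()
  ... | inj₂ (i1 , ei) rewrite i1 | ei = odd-corner j jᵢ
    where
    odd-corner : ∀ j → toℕ j % 2 ≡ 1 → out (cornersOf (frame i) j) ≡ cornersOf (advance false (frame i)) j
    odd-corner fz ()
    odd-corner (fs fz) _ = refl
    odd-corner (fs (fs fz)) ()
    odd-corner (fs (fs (fs fz))) _ = out-opp _

  ℓ : ℕ
  ℓ = m % 2

  twist : Fin 4 → Fin 4
  twist j = fromℕ< (m%n<n (toℕ j + ℓ) 4)

  m-parity : (k % 2 ≡ 0 × ℓ ≡ 1 × even k ≡ true) ⊎ (k % 2 ≡ 1 × ℓ ≡ 0 × even k ≡ false)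
  m-parity = subst (λ n → (k % 2 ≡ 0 × n % 2 ≡ 1 × even k ≡ true)
                         ⊎ (k % 2 ≡ 1 × n % 2 ≡ 0 × even k ≡ false))
               1+k≡m (parity-suc k)

  twist-odd : ℓ ≡ 1 → ∀ j → twist j ≡ next j
  twist-odd ℓ1 j = toℕ-injective (begin
    toℕ (twist j)         ≡⟨ toℕ-fromℕ< _ ⟩
    (toℕ j + ℓ) % 4       ≡⟨ cong (λ n → (toℕ j + n) % 4) ℓ1 ⟩
    (toℕ j + 1) % 4       ≡⟨ sym (toℕ-next j) ⟩
    toℕ (next j)          ∎)

  twist-even : ℓ ≡ 0 → ∀ j → twist j ≡ j
  twist-even ℓ0 j = toℕ-injective (begin
    toℕ (twist j)         ≡⟨ toℕ-fromℕ< _ ⟩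
    (toℕ j + ℓ) % 4       ≡⟨ cong (λ n → (toℕ j + n) % 4) ℓ0 ⟩
    (toℕ j + 0) % 4       ≡⟨ cong (_% 4) (+-identityʳ (toℕ j)) ⟩
    toℕ j % 4             ≡⟨ m<n⇒m%n≡m (toℕ<n j) ⟩
    toℕ j                 ∎)

  out-vertexAt-last : ∀ j → toℕ j % 2 ≡ k % 2 → out (vertexAt k j) ≡ vertexAt 0 (twist j)
  out-vertexAt-last j jₖ rewrite frame-last with m-parity
  ... | inj₁ (k0 , ℓ1 , ek) rewrite twist-odd ℓ1 j | k0 = even-corner j jₖ
    where
    closing≡ : closing ≡ out (proj₁ last-frame)
    closing≡ = cong (λ b → out (if b then proj₁ last-frame else proj₂ last-frame)) ek
    even-corner : ∀ j → toℕ j % 2 ≡ 0 → out (cornersOf last-frame j) ≡ vertexAt 0 (next j)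
    even-corner fz _ = sym closing≡
    even-corner (fs fz) ()
    even-corner (fs (fs fz)) _ = trans (out-opp _) (cong opp (sym closing≡))
    even-corner (fs (fs (fs fz))) ()
  ... | inj₂ (k1 , ℓ0 , ek) rewrite twist-even ℓ0 j | k1 = odd-corner j jₖ
    where
    closing≡ : closing ≡ out (proj₂ last-frame)
    closing≡ = cong (λ b → out (if b then proj₁ last-frame else proj₂ last-frame)) ek
    odd-corner : ∀ j → toℕ j % 2 ≡ 1 → out (cornersOf last-frame j) ≡ vertexAt 0 j
    odd-corner fz ()
    odd-corner (fs fz) _ = sym closing≡
    odd-corner (fs (fs fz)) ()
    odd-corner (fs (fs (fs fz))) _ = trans (out-opp _) (cong opp (sym closing≡))

  -- The arcs of HTG(m,4,ℓ) between consecutive 4-cycles (the last two summands of HTGArc).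
  Rung : Fin m × Fin 4 → Fin m × Fin 4 → Set
  Rung (i , j) (i′ , j′) =
      (suc (toℕ i) ≡ toℕ i′ × j ≡ j′ × toℕ j % 2 ≡ toℕ i % 2)
    ⊎ (suc (toℕ i) ≡ m × toℕ i′ ≡ 0 × toℕ j % 2 ≡ toℕ i % 2 × toℕ j′ ≡ (toℕ j + ℓ) % 4)

  coords : Fin m × Fin 4 → Fin N
  coords (i , j) = vertexAt (toℕ i) j

  rung-out : ∀ x y → Rung x y → coords y ≡ out (coords x)
  rung-out (i , j) (i′ , .j) (inj₁ (1+i≡i′ , refl , jᵢ)) = sym (begin
    out (vertexAt (toℕ i) j)    ≡⟨ out-vertexAt-suc j (subst (_< m) (sym 1+i≡i′) (toℕ<n i′)) jᵢ ⟩
    vertexAt (suc (toℕ i)) j    ≡⟨ cong (λ n → vertexAt n j) 1+i≡i′ ⟩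
    vertexAt (toℕ i′) j         ∎)
  rung-out (i , j) (i′ , j′) (inj₂ (1+i≡m , i′≡0 , jᵢ , j′≡)) = sym (begin
    out (vertexAt (toℕ i) j)    ≡⟨ cong (λ n → out (vertexAt n j)) i≡k ⟩
    out (vertexAt k j)          ≡⟨ out-vertexAt-last j (subst (λ n → toℕ j % 2 ≡ n % 2) i≡k jᵢ) ⟩
    vertexAt 0 (twist j)        ≡⟨ cong₂ vertexAt (sym i′≡0) (toℕ-injective (trans (toℕ-fromℕ< _) (sym j′≡))) ⟩
    vertexAt (toℕ i′) j′        ∎)
    where
    i≡k : toℕ i ≡ k
    i≡k = suc-injective (trans 1+i≡m (sym 1+k≡m))

  rung-from : ∀ i j → toℕ j % 2 ≡ toℕ i % 2 → ∃ λ y → Rung (i , j) y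
  rung-from i j jᵢ with suc (toℕ i) Data.Nat.≟ m
  ... | yes 1+i≡m = (label-zero , twist j) , inj₂ (1+i≡m , toℕ-fromℕ< 0<m , jᵢ , toℕ-fromℕ< _)
  ... | no 1+i≢m = (fromℕ< (≤∧≢⇒< (toℕ<n i) 1+i≢m) , j) , inj₁ (sym (toℕ-fromℕ< _) , refl , jᵢ)

  square-of : ∀ i → Square (proj₁ (frame (toℕ i))) (proj₂ (frame (toℕ i)))
                             (opp (proj₁ (frame (toℕ i)))) (opp (proj₂ (frame (toℕ i))))
  square-of i = Square-on (proj₁ (frame-Framed (toℕ i) (toℕ<n i)))

  label-coords : ∀ i j → label (coords (i , j)) ≡ i
  label-coords i j = toℕ-injective (trans (cong toℕ (sym (SameCycle⇒label (corner-SameCycle j))))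
                                           (proj₁ (proj₂ (frame-Framed (toℕ i) (toℕ<n i)))))
    where open Corners (square-of i)

  coords-injective : ∀ x y → coords x ≡ coords y → x ≡ y
  coords-injective (i , j) (i′ , j′) eq
    with trans (sym (label-coords i j)) (trans (cong label eq) (label-coords i′ j′))
  ... | refl = cong (i ,_) (Corners.corner-injective (square-of i) j j′ eq)

  coords-onto : ∀ v → ∃ λ j → coords (label v , j) ≡ v
  coords-onto v = Corners.corner-onto (square-of (label v)) (label⇒SameCycle (label-coords (label v) fz))

  coords⁻¹ : Fin N → Fin m × Fin 4
  coords⁻¹ v = label v , proj₁ (coords-onto v)

  coords∘coords⁻¹ : ∀ v → coords (coords⁻¹ v) ≡ v
  coords∘coords⁻¹ v = proj₂ (coords-onto v)

  coords⁻¹∘coords : ∀ x → coords⁻¹ (coords x) ≡ x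
  coords⁻¹∘coords x = coords-injective _ _ (coords∘coords⁻¹ (coords x))

  ascends?-coords : ∀ i j → ascends? (coords (i , j)) ≡ does (toℕ j % 2 Data.Nat.≟ toℕ i % 2)
  ascends?-coords i j = begin
    ascends? (coords (i , j))
      ≡⟨ ascends?-corner (proj₁ framed) j ⟩
    (if even (toℕ j) then ascends? p else not (ascends? p))
      ≡⟨ cong (λ b → if even (toℕ j) then b else not b) (proj₂ (proj₂ framed)) ⟩
    (if even (toℕ j) then even (toℕ i) else not (even (toℕ i)))
      ≡⟨ even-agreement (toℕ i) (toℕ j) ⟩
    does (toℕ j % 2 Data.Nat.≟ toℕ i % 2)
      ∎
    where
    p : Fin N
    p = proj₁ (frame (toℕ i))
    framed : Framed (toℕ i) (frame (toℕ i))
    framed = frame-Framed (toℕ i) (toℕ<n i)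

  -- An outside edge is a rung from whichever end ascends.
  outside⇒HTGAdj : ∀ x y → coords y ≡ out (coords x) → HTGAdj m 4 ℓ x y
  outside⇒HTGAdj (i , j) y y≡out with toℕ j % 2 Data.Nat.≟ toℕ i % 2
  ... | yes jᵢ with rung-from i j jᵢ
  ...   | y′ , r with coords-injective y′ y (trans (rung-out _ y′ r) (sym y≡out))
  ...     | refl = inj₁ (inj₂ r)
  outside⇒HTGAdj (i , j) (i′ , j′) y≡out | no ¬jᵢ with toℕ j′ % 2 Data.Nat.≟ toℕ i′ % 2
  ... | yes j′ᵢ′ with rung-from i′ j′ j′ᵢ′
  ...   | x′ , r
    with coords-injective x′ (i , j) (trans (rung-out _ x′ r) (trans (cong out y≡out) (out-involutive _)))
  ...     | refl = inj₂ (inj₂ r)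
  outside⇒HTGAdj (i , j) (i′ , j′) y≡out | no ¬jᵢ | no ¬j′ᵢ′ = contradiction (begin
    true                              ≡⟨ cong not (sym (trans (ascends?-coords i j) (dec-false (_ Data.Nat.≟ _) ¬jᵢ))) ⟩
    not (ascends? (coords (i , j)))   ≡⟨ sym (ascends?-out _) ⟩
    ascends? (out (coords (i , j)))   ≡⟨ cong ascends? (sym y≡out) ⟩
    ascends? (coords (i′ , j′))       ≡⟨ trans (ascends?-coords i′ j′) (dec-false (_ Data.Nat.≟ _) ¬j′ᵢ′) ⟩
    false                             ∎) λ ()

  Adj⇒HTGAdj : ∀ x y → Adj (coords x) (coords y) → HTGAdj m 4 ℓ x y
  Adj⇒HTGAdj (i , j) (i′ , j′) xy with Adj⇒CEdge⊎out xy
  ... | inj₂ y≡out = outside⇒HTGAdj (i , j) (i′ , j′) y≡out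
  ... | inj₁ e with Corners.corner-neighbours (square-of i) j e
  ...   | inj₁ eq with coords-injective (i′ , j′) (i , next j) eq
  ...     | refl = inj₁ (inj₁ (refl , toℕ-next j))
  Adj⇒HTGAdj (i , j) (i′ , j′) xy | inj₁ e | inj₂ eq with coords-injective (i′ , j′) (i , prev j) eq
  ... | refl = inj₂ (inj₁ (refl , toℕ-prev j))

  HTGArc⇒Adj : ∀ x y → HTGArc m 4 ℓ x y → Adj (coords x) (coords y)
  HTGArc⇒Adj (i , j) (.i , j′) (inj₁ (refl , j′≡)) =
    subst (λ j″ → Adj (coords (i , j)) (coords (i , j″))) (toℕ-injective (trans (toℕ-next j) (sym j′≡)))
      (CEdge⇒Adj (Corners.corner-CEdge (square-of i) j))
  HTGArc⇒Adj x y (inj₂ r) = subst (Adj (coords x)) (sym (rung-out x y r)) (out-Adj _)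

  ≅HTG : IsoHTG Γ m 4 ℓ
  ≅HTG = mk↔ₛ′ coords⁻¹ coords coords⁻¹∘coords coords∘coords⁻¹ , λ u v → mk⇔
    (λ uv → Adj⇒HTGAdj (coords⁻¹ u) (coords⁻¹ v)
              (subst₂ Adj (sym (coords∘coords⁻¹ u)) (sym (coords∘coords⁻¹ v)) uv))
    (λ arc → subst₂ Adj (coords∘coords⁻¹ u) (coords∘coords⁻¹ v) (HTGAdj⇒Adj _ _ arc))
    where
    HTGAdj⇒Adj : ∀ x y → HTGAdj m 4 ℓ x y → Adj (coords x) (coords y)
    HTGAdj⇒Adj x y (inj₁ arc) = HTGArc⇒Adj x y arc
    HTGAdj⇒Adj x y (inj₂ arc) = Adj-sym (HTGArc⇒Adj y x arc)

module SquaresAndAutomorphisms {N : ℕ} {Γ : SimpleGraph N} (F : TwoOneFactorisation Γ)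
    (squares : ∀ v → MemberIs4Cycle F v) (alternating : Alternating F)
    (out-leaves : ∀ v → ¬ SameCycle F v (Factorisation.out F v)) where

  open Factorisation F
  open Squares F squares

  -- u v x y is a 4-cycle of Γ; the other distinctness conditions hold as Γ is simple.
  OnSquare : Fin N → Fin N → Set
  OnSquare u v = ∃ λ x → ∃ λ y → Adj u v × Adj v x × Adj x y × Adj y u × u ≢ x × v ≢ y

  CEdge⇒OnSquare : ∀ {u v} → CEdge u v → OnSquare u v
  CEdge⇒OnSquare uv = _ , _ , CEdge⇒Adj e₀₁ , CEdge⇒Adj e₁₂ , CEdge⇒Adj e₂₃ , CEdge⇒Adj e₃₀ , d₀₂ , d₁₃
    where open Square (Square-on uv)

  out-¬OnSquare : ∀ u → ¬ OnSquare u (out u)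
  out-¬OnSquare u (x , y , _ , vx , xy , yu , u≢x , v≢y) with Adj⇒CEdge⊎out vx | Adj⇒CEdge⊎out (Adj-sym yu)
  ... | inj₂ x≡u | _ = u≢x (sym (trans x≡u (out-involutive u)))
  ... | inj₁ _ | inj₂ y≡v = v≢y (sym y≡v)
  ... | inj₁ cvx | inj₁ cuy with Adj⇒CEdge⊎out xy
  ...   | inj₁ cxy = out-leaves u (step cuy (step (CEdge-sym cxy) (CEdge⇒SameCycle (CEdge-sym cvx))))
  ...   | inj₂ refl = alternating (out u) x u (out x) cvx
                        (Adj-sym (out-Adj u) , trans (C-sym F (out u) u) (proj₂ (out-IsOutside u)))
                        (out-IsOutside x) (CEdge⇒SameCycle cuy)

  module _ (σ : Permutation′ N) (σ-aut : IsAut Γ σ) where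

    OnSquare-image : ∀ {u v} → OnSquare u v → OnSquare (σ ⟨$⟩ʳ u) (σ ⟨$⟩ʳ v)
    OnSquare-image (x , y , uv , vx , xy , yu , u≢x , v≢y) =
      σ ⟨$⟩ʳ x , σ ⟨$⟩ʳ y , image uv , image vx , image xy , image yu ,
      u≢x ∘ permutation-injective σ , v≢y ∘ permutation-injective σ
      where
      image : ∀ {a b} → Adj a b → Adj (σ ⟨$⟩ʳ a) (σ ⟨$⟩ʳ b)
      image = trans (σ-aut _ _)

    -- 𝒞-edges are exactly the edges on 4-cycles, which automorphisms preserve.
    CEdge-image : ∀ {u v} → CEdge u v → CEdge (σ ⟨$⟩ʳ u) (σ ⟨$⟩ʳ v)
    CEdge-image {u} uv with OnSquare-image (CEdge⇒OnSquare uv)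
    ... | sq with Adj⇒CEdge⊎out (proj₁ (proj₂ (proj₂ sq)))
    ...   | inj₁ e = e
    ...   | inj₂ eq = contradiction (subst (OnSquare (σ ⟨$⟩ʳ u)) eq sq) (out-¬OnSquare _)

  Aut-preserves : ∀ σ → IsAut Γ σ → Preserves F σ
  Aut-preserves σ σ-aut u v = mk⇔ (Reach-map (σ ⟨$⟩ʳ_) (CEdge-image σ σ-aut))
    (subst₂ (SameCycle F) (inverseˡ σ) (inverseˡ σ) ∘ Reach-map (σ ⟨$⟩ˡ_) (CEdge-image (flip σ) σ⁻¹-aut))
    where
    σ⁻¹-aut : IsAut Γ (flip σ)
    σ⁻¹-aut a b = trans (sym (σ-aut (σ ⟨$⟩ˡ a) (σ ⟨$⟩ˡ b))) (cong₂ (adj Γ) (inverseʳ σ) (inverseʳ σ))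

distinct-cycles : ∀ {N} {Γ : SimpleGraph N} (F : TwoOneFactorisation Γ) m .{{_ : NonZero m}} →
  QuotientIsCycle F m → ∃ λ u → ∃ λ v → ¬ SameCycle F u v
distinct-cycles F m (3≤m , label , onto , label⇔ , _) =
  let (u , lu) = onto (fromℕ< 0<m)
      (v , lv) = onto (fromℕ< 1<m)
  in u , v , λ uv → contradiction
       (trans (sym (toℕ-fromℕ< 0<m))
         (trans (cong toℕ (trans (sym lu) (trans (Equivalence.from (label⇔ u v) uv) lv))) (toℕ-fromℕ< 1<m)))
       λ ()
  where
  0<m : 0 < m
  0<m = ≤-trans (s≤s z≤n) 3≤m
  1<m : 1 < m
  1<m = ≤-trans (s≤s (s≤s z≤n)) 3≤m

proposition4p1 : {N : ℕ} (Γ : SimpleGraph N) → Connected Γ → Cubic Γ → VertexTransitive Γ →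
    (F : TwoOneFactorisation Γ) → (m : ℕ) → .{{_ : NonZero m}} →
    AlternatingCycleQuotientType F m →
    (G : Permutation′ N → Set) → IsAutSubgroup Γ G → TransitiveOn G →
    (∀ σ → G σ → Preserves F σ) →
    (∀ v → MemberIs4Cycle F v) →
    (∃[ ℓ ] (ℓ ≡ 0 ⊎ ℓ ≡ 1) × ℓ % 2 ≡ m % 2 × IsoHTG Γ m 4 ℓ)
    × (∀ σ → IsAut Γ σ → Preserves F σ)
proposition4p1 Γ connected cubic _ F m (quotient , alternating) G G≤Aut G-transitive G-preserves squares =
  (m % 2 , Sum.map proj₁ proj₁ (parity m) , m%n%n≡m%n m 2 , ≅HTG) ,
  SquaresAndAutomorphisms.Aut-preserves F squares alternating out-leaves
  where
  out-leaves : ∀ v → ¬ SameCycle F v (Factorisation.out F v)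
  out-leaves = OutsideEdges.no-chord connected cubic F squares G G≤Aut G-transitive G-preserves
                 (proj₂ (proj₂ (distinct-cycles F m quotient)))
  open Coordinates F squares m quotient alternating out-leaves using (≅HTG)
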